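{- Let $p\in\mathrm{OFS}(\mathbb{Z}^+)$ with $|p|>1$ and let $k\ge1$. Then the map $\alpha_{p,k}:\{1,\ldots,k\}\to\{1,\ldots,p_1+k\}$, $\alpha_{p,k}(i)=p_1+i$, sends each connected component of $G(R(p),k)$ into a connected component of $G(p,p_1+k)$, and the induced map from the set of components of $G(R(p),k)$ to the set of components of $G(p,p_1+k)$ is injective.
   Context: $\mathrm{OFS}(\mathbb{Z}^+)$ denotes the set of all nonempty strictly increasing finite sequences of positive integers. For $p\in\mathrm{OFS}(\mathbb{Z}^+)$, $|p|$ is its length, $p_i$ its $i$-th entry. The map $R$: $R(p)=p$ if $|p|=1$; if $n=|p|>1$, form $(p_2-p_1,\ldots,p_n-p_1)$ and, if $p_1$ does not appear in it, insert $p_1$ so that the result is strictly increasing. For a positive integer $k$ and $q\in\mathrm{OFS}(\mathbb{Z}^+)$, $G(q,k)$ is the simple graph with vertex set $\{1,\ldots,k\}$ and edges $\{i,j\}$ with $|i-j|=q_t$ for some $t$. -}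

module Defs where

open import Data.Nat using (ℕ; zero; suc; _+_; _∸_; _≤_; _<_; _≡ᵇ_; ∣_-_∣; _≤ᵇ_)
open import Data.Bool using (Bool; true; false; if_then_else_)
open import Data.List using (List; []; _∷_; map; length)
open import Data.Bool.ListAction using (any)
open import Data.List.Relation.Unary.All using (All)
open import Data.List.Relation.Unary.Linked using (Linked)
open import Data.List.Membership.Propositional using (_∈_)
open import Data.Product using (_×_; ∃-syntax)
open import Relation.Binary.PropositionalEquality using (_≡_)
open import Relation.Binary.Construct.Closure.ReflexiveTransitive using (Star)

IsOFS : List ℕ → Set
IsOFS p = (1 ≤ length p) × Linked _<_ p × All (1 ≤_) p

insertSorted : ℕ → List ℕ → List ℕ
insertSorted x [] = x ∷ []
insertSorted x (y ∷ ys) = if x ≤ᵇ y then x ∷ y ∷ ys else y ∷ insertSorted x ys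

R : List ℕ → List ℕ
R [] = []
R (x ∷ []) = x ∷ []
R (x ∷ y ∷ ys) =
  let d = map (λ z → z ∸ x) (y ∷ ys) in
  if any (λ z → z ≡ᵇ x) d then d else insertSorted x d

-- edge relation of G(q,k) on vertex set {1,…,k} (vertices as naturals)
Adj : List ℕ → ℕ → ℕ → ℕ → Set
Adj q k i j = (1 ≤ i × i ≤ k) × (1 ≤ j × j ≤ k) × (∃[ t ] (t ∈ q × ∣ i - j ∣ ≡ t))

Vertex : ℕ → ℕ → Set
Vertex k i = 1 ≤ i × i ≤ k

Connected : List ℕ → ℕ → ℕ → ℕ → Set
Connected q k = Star (Adj q k)

α : ℕ → ℕ → ℕ
α p₁ i = p₁ + i

module Submission where

-- Write p = x ∷ tail.  Since p is strictly increasing, every z ∈ tail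
-- has the form c + x, and R p consists of x together with these shifts c
-- ("Q = {x} ∪ {c | c + x ∈ tail}").  Connectivity is preserved by any vertex map
-- sending each oriented edge a → a + t of one graph to a path of the other
-- (Star's Kleisli extension), so both directions reduce to single edges:
--   * embedding i ↦ x + i, from G(R p, k) to G(p, x + k): an x-edge stays an
--     x-edge, and a c-edge a → a + c becomes x + a ← a → a + (c + x) = x + (a + c);
--   * projection π (v ≤ x ↦ v, a + x ↦ a), from G(p, x + k) to G(R p, k): an
--     edge from v to v + t becomes a path of length 0, 1 or 2, depending on
--     whether v is low or high and whether t = x or t = c + x.
-- Since π (x + i) = i, the projection shows that the embedding reflects
-- connectivity, which is the injectivity on components.

open import Defs
open import Data.Nat using (ℕ; _+_; _≤_; _<_; _∸_; _≡ᵇ_; _≤ᵇ_; _≤?_)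
open import Data.Nat.Properties
open import Data.Nat.Tactic.RingSolver using (solve-∀)
open import Data.Bool using (true; false; T)
open import Data.Bool.ListAction using (any)
open import Data.Unit using (tt)
open import Data.List using (List; []; _∷_; map)
open import Data.List.Relation.Unary.Any as Any using (here; there)
open import Data.List.Relation.Unary.Any.Properties using (any⁻)
open import Data.List.Relation.Unary.Linked using (Linked; _∷_)
open import Data.List.Membership.Propositional using (_∈_)
open import Data.List.Membership.Propositional.Properties using (∈-map⁺; ∈-map⁻)
open import Data.Product using (_×_; _,_; ∃-syntax)
open import Data.Sum using (_⊎_; inj₁; inj₂)
open import Relation.Nullary using (yes; no; contradiction)
open import Relation.Binary.PropositionalEquality
open import Relation.Binary.Construct.Closure.ReflexiveTransitive
  using (ε; _◅_; _◅◅_; reverse; return; kleisliStar)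

Step : List ℕ → ℕ → ℕ → ℕ → Set
Step q k a b = Vertex k a × Vertex k b × ∃[ t ] (t ∈ q × a + t ≡ b)

step⇒adj : ∀ {q k a b} → Step q k a b → Adj q k a b
step⇒adj {a = a} (va , vb , t , t∈q , refl) = va , vb , t , t∈q , ∣m-m+n∣≡n a t

adj-sym : ∀ {q k a b} → Adj q k a b → Adj q k b a
adj-sym {a = a} {b} (va , vb , t , t∈q , d) = vb , va , t , t∈q , trans (∣-∣-comm b a) d

adj⇒step : ∀ {q k a b} → Adj q k a b → Step q k a b ⊎ Step q k b a
adj⇒step {a = a} {b} (va , vb , t , t∈q , d) with ≤-total a b
... | inj₁ a≤b = inj₁ (va , vb , t , t∈q , (begin
  a + t            ≡⟨ cong (a +_) (trans (sym d) (m≤n⇒∣m-n∣≡n∸m a≤b)) ⟩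
  a + (b ∸ a)      ≡⟨ m+[n∸m]≡n a≤b ⟩
  b                ∎))
  where open ≡-Reasoning
... | inj₂ b≤a = inj₂ (vb , va , t , t∈q , (begin
  b + t            ≡⟨ cong (b +_) (trans (sym d) (m≤n⇒∣n-m∣≡n∸m b≤a)) ⟩
  b + (a ∸ b)      ≡⟨ m+[n∸m]≡n b≤a ⟩
  a                ∎))
  where open ≡-Reasoning

connected-map : ∀ {q k q′ k′} (f : ℕ → ℕ) →
  (∀ {a b} → Step q k a b → Connected q′ k′ (f a) (f b)) →
  ∀ {a b} → Connected q k a b → Connected q′ k′ (f a) (f b)
connected-map f step = kleisliStar f edge
  where
  edge : ∀ {a b} → Adj _ _ a b → Connected _ _ (f a) (f b)
  edge e with adj⇒step e
  ... | inj₁ s = step s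
  ... | inj₂ s = reverse adj-sym (step s)

insertSorted-∈-new : ∀ x l → x ∈ insertSorted x l
insertSorted-∈-new x [] = here refl
insertSorted-∈-new x (y ∷ ys) with x ≤ᵇ y
... | true  = here refl
... | false = there (insertSorted-∈-new x ys)

insertSorted-∈-old : ∀ x {a} l → a ∈ l → a ∈ insertSorted x l
insertSorted-∈-old x (y ∷ ys) a∈l with x ≤ᵇ y
insertSorted-∈-old x (y ∷ ys) a∈l         | true  = there a∈l
insertSorted-∈-old x (y ∷ ys) (here a≡y)  | false = here a≡y
insertSorted-∈-old x (y ∷ ys) (there a∈l) | false = there (insertSorted-∈-old x ys a∈l)

insertSorted-∈⁻ : ∀ x {a} l → a ∈ insertSorted x l → a ≡ x ⊎ a ∈ l
insertSorted-∈⁻ x [] (here a≡x) = inj₁ a≡x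
insertSorted-∈⁻ x (y ∷ ys) a∈ with x ≤ᵇ y
insertSorted-∈⁻ x (y ∷ ys) (here a≡x)  | true  = inj₁ a≡x
insertSorted-∈⁻ x (y ∷ ys) (there a∈l) | true  = inj₂ a∈l
insertSorted-∈⁻ x (y ∷ ys) (here a≡y)  | false = inj₂ (here a≡y)
insertSorted-∈⁻ x (y ∷ ys) (there a∈)  | false with insertSorted-∈⁻ x ys a∈
... | inj₁ a≡x  = inj₁ a≡x
... | inj₂ a∈ys = inj₂ (there a∈ys)

module RMembers (x y : ℕ) (ys : List ℕ) where

  differences : List ℕ
  differences = map (_∸ x) (y ∷ ys)

  R-head : x ∈ R (x ∷ y ∷ ys)
  R-head with any (_≡ᵇ x) differences in found
  ... | true  = Any.map (λ {w} w≡ᵇx → sym (≡ᵇ⇒≡ w x w≡ᵇx))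
                        (any⁻ (_≡ᵇ x) differences (subst T (sym found) tt))
  ... | false = insertSorted-∈-new x differences

  R-shift : ∀ {z} → z ∈ y ∷ ys → z ∸ x ∈ R (x ∷ y ∷ ys)
  R-shift z∈ with any (_≡ᵇ x) differences
  ... | true  = ∈-map⁺ (_∸ x) z∈
  ... | false = insertSorted-∈-old x differences (∈-map⁺ (_∸ x) z∈)

  R-cases : ∀ {t} → t ∈ R (x ∷ y ∷ ys) → t ≡ x ⊎ ∃[ z ] (z ∈ y ∷ ys × t ≡ z ∸ x)
  R-cases t∈ with any (_≡ᵇ x) differences
  ... | true  = inj₂ (∈-map⁻ (_∸ x) t∈)
  ... | false with insertSorted-∈⁻ x differences t∈
  ...   | inj₁ t≡x = inj₁ t≡x
  ...   | inj₂ t∈d = inj₂ (∈-map⁻ (_∸ x) t∈d)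

linked-head< : ∀ {a z} {l : List ℕ} → Linked _<_ (a ∷ l) → z ∈ l → a < z
linked-head< (a<b ∷ _)  (here refl) = a<b
linked-head< (a<b ∷ lk) (there z∈)  = <-trans a<b (linked-head< lk z∈)

shift-past : ∀ a t x → a + (t + x) ≡ x + (a + t)
shift-past = solve-∀

high-plus-shift : ∀ a c x → a + x + (c + x) ≡ a + c + x + x
high-plus-shift = solve-∀

module Components (x y : ℕ) (ys : List ℕ) (x≤tail : ∀ {z} → z ∈ y ∷ ys → x ≤ z) (k : ℕ) where
  open RMembers x y ys

  P Q : List ℕ
  P = x ∷ y ∷ ys
  Q = R P

  tail-shift : ∀ {z} → z ∈ y ∷ ys → ∃[ c ] (z ≡ c + x)
  tail-shift z∈ = _ , sym (m∸n+n≡m (x≤tail z∈))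

  Q-shift : ∀ {c} → c + x ∈ y ∷ ys → c ∈ Q
  Q-shift {c} c+x∈ = subst (_∈ Q) (m+n∸n≡m c x) (R-shift c+x∈)

  Q-cases : ∀ {t} → t ∈ Q → t ≡ x ⊎ t + x ∈ y ∷ ys
  Q-cases t∈ with R-cases t∈
  ... | inj₁ t≡x = inj₁ t≡x
  ... | inj₂ (z , z∈ , refl) = inj₂ (subst (_∈ y ∷ ys) (sym (m∸n+n≡m (x≤tail z∈))) z∈)

  shift-vertex : ∀ {i} → Vertex k i → Vertex (x + k) (x + i)
  shift-vertex {i} (1≤i , i≤k) = ≤-trans 1≤i (m≤n+m i x) , +-monoʳ-≤ x i≤k

  widen-vertex : ∀ {i} → Vertex k i → Vertex (x + k) i
  widen-vertex (1≤i , i≤k) = 1≤i , ≤-trans i≤k (m≤n+m k x)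

  embed-step : ∀ {a b} → Step Q k a b → Connected P (x + k) (x + a) (x + b)
  embed-step {a} (va , vb , t , t∈ , refl) with Q-cases t∈
  ... | inj₁ refl = return (step⇒adj (shift-vertex va , shift-vertex vb , x , here refl , +-assoc x a x))
  ... | inj₂ t+x∈ =
          adj-sym (step⇒adj (widen-vertex va , shift-vertex va , x , here refl , +-comm a x))
        ◅ return (step⇒adj (widen-vertex va , shift-vertex vb , t + x , there t+x∈ , shift-past a t x))

  π : ℕ → ℕ
  π v with v ≤? x
  ... | yes _ = v
  ... | no  _ = v ∸ x

  π-low : ∀ {v} → v ≤ x → π v ≡ v
  π-low {v} v≤x with v ≤? x
  ... | yes _   = refl
  ... | no  v≰x = contradiction v≤x v≰x

  π-high : ∀ {a} → 1 ≤ a → π (a + x) ≡ a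
  π-high {a} 1≤a with a + x ≤? x
  ... | yes a+x≤x = contradiction a+x≤x (<⇒≱ (m<n+m x 1≤a))
  ... | no  _     = m+n∸n≡m a x

  Q-edge : ∀ {a t} → t ∈ Q → 1 ≤ a → a + t ≤ k → Connected Q k a (a + t)
  Q-edge {a} {t} t∈ 1≤a a+t≤k =
    return (step⇒adj ((1≤a , ≤-trans (m≤m+n a t) a+t≤k) , (≤-trans 1≤a (m≤m+n a t) , a+t≤k) , t , t∈ , refl))

  unshift-bound : ∀ w → w + x ≤ x + k → w ≤ k
  unshift-bound w le = +-cancelʳ-≤ x w k (subst (w + x ≤_) (+-comm x k) le)

  low-or-high : ∀ v → v ≤ x ⊎ ∃[ a ] (1 ≤ a × v ≡ a + x)
  low-or-high v with v ≤? x
  ... | yes v≤x = inj₁ v≤x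
  ... | no  v≰x = inj₂ (v ∸ x , m<n⇒0<n∸m (≰⇒> v≰x) , sym (m∸n+n≡m (<⇒≤ (≰⇒> v≰x))))

  -- Cases:
  -- low u, step x: both ends go to u; low u, step c + x: the c-edge u → u + c;
  -- high a + x, step x: the x-edge a → a + x; high a + x, step c + x: the
  -- path a → a + c → a + c + x.
  project-step : ∀ {u w} → Step P (x + k) u w → Connected Q k (π u) (π w)
  project-step {u} ((1≤u , _) , (_ , w≤K) , t , t∈ , refl) with low-or-high u
  project-step {u} ((1≤u , _) , (_ , w≤K) , t , here refl , refl) | inj₁ u≤x
    rewrite π-low u≤x | π-high 1≤u = ε
  project-step {u} ((1≤u , _) , (_ , w≤K) , t , there t∈ , refl) | inj₁ u≤x
    with tail-shift t∈
  ... | c , refl rewrite π-low u≤x | sym (+-assoc u c x) | π-high (≤-trans 1≤u (m≤m+n u c)) =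
    Q-edge (Q-shift t∈) 1≤u (unshift-bound (u + c) w≤K)
  project-step {u} ((1≤u , _) , (_ , w≤K) , t , here refl , refl) | inj₂ (a , 1≤a , refl)
    rewrite π-high 1≤a | π-high (≤-trans 1≤a (m≤m+n a x)) =
    Q-edge R-head 1≤a (unshift-bound (a + x) w≤K)
  project-step {u} ((1≤u , _) , (_ , w≤K) , t , there t∈ , refl) | inj₂ (a , 1≤a , refl)
    with tail-shift t∈
  ... | c , refl rewrite high-plus-shift a c x | π-high 1≤a
                       | π-high (≤-trans 1≤a (≤-trans (m≤m+n a c) (m≤m+n (a + c) x))) =
    Q-edge (Q-shift t∈) 1≤a (≤-trans (m≤m+n (a + c) x) a+c+x≤k)
      ◅◅ Q-edge R-head (≤-trans 1≤a (m≤m+n a c)) a+c+x≤k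
    where
    a+c+x≤k : a + c + x ≤ k
    a+c+x≤k = unshift-bound (a + c + x) w≤K

  π-shift : ∀ {i} → Vertex k i → π (x + i) ≡ i
  π-shift {i} (1≤i , _) = trans (cong π (+-comm x i)) (π-high 1≤i)

-- α = x +_ maps vertices to vertices, preserves connectivity (so components go into
-- components) and reflects it via π (so the induced map on components is injective).
proposition26 : (x y : ℕ) (ys : List ℕ) → IsOFS (x ∷ y ∷ ys) → (k : ℕ) → 1 ≤ k →
    ((i : ℕ) → Vertex k i → Vertex (x + k) (α x i))
    × ((i j : ℕ) → Vertex k i → Vertex k j →
        Connected (R (x ∷ y ∷ ys)) k i j → Connected (x ∷ y ∷ ys) (x + k) (α x i) (α x j))
    × ((i j : ℕ) → Vertex k i → Vertex k j →
        Connected (x ∷ y ∷ ys) (x + k) (α x i) (α x j) → Connected (R (x ∷ y ∷ ys)) k i j)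
proposition26 x y ys (_ , increasing , _) k _ =
    (λ i → shift-vertex)
  , (λ i j _ _ → connected-map (x +_) embed-step)
  , (λ i j vi vj i~j → subst₂ (Connected Q k) (π-shift vi) (π-shift vj)
                                (connected-map π project-step i~j))
  where
  open Components x y ys (λ z∈ → <⇒≤ (linked-head< increasing z∈)) k
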